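{- Let $m,n,n',r,r',s$ be positive integers with $mr'$ even. Suppose there exists a shiftable $SMR(m,n;r,s)$ and there exists an $SMR(m,n';r',s)$. Then for every integer $k\geq 1$ there exists an $SMR(m,kn+n';kr+r',s)$; moreover, if the given $SMR(m,n';r',s)$ is shiftable, then there exists a shiftable $SMR(m,kn+n';kr+r',s)$.
   Context: A signed magic rectangle $SMR(m,n;r,s)$ is an $m\times n$ array, some of whose cells are filled with integers and the others empty, such that exactly $r$ cells in every row and exactly $s$ cells in every column are filled (so $mr=ns$), every element of a set $X$ appears exactly once in the array, and the sum of the entries of each row and of each column is zero. Here $X=\{\pm1,\pm2,\ldots,\pm mr/2\}$ if $mr$ is even, and $X=\{0,\pm1,\ldots,\pm (mr-1)/2\}$ if $mr$ is odd. An array is shiftable if every row and every column contains the same number of positive entries as negative entries. -}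

module Defs where

open import Data.Nat as ℕ using (ℕ; suc; _*_; _/_; _%_)
open import Data.Integer as ℤ using (ℤ; +_; -[1+_]; 0ℤ)
open import Data.Fin using (Fin)
open import Data.Maybe using (Maybe; just; nothing)
open import Data.List using (List; []; _∷_; _++_; tabulate; catMaybes; concat; length; foldr; upTo; map; filter)
open import Data.List.Relation.Binary.Permutation.Propositional using (_↭_)
open import Data.Product using (_×_)
open import Relation.Binary.PropositionalEquality using (_≡_)

-- A partially filled m × n array of integers: 'nothing' = empty cell.
Array : ℕ → ℕ → Set
Array m n = Fin m → Fin n → Maybe ℤ

rowEntries : ∀ {m n} → Array m n → Fin m → List ℤ
rowEntries {n = n} A i = catMaybes (tabulate (λ j → A i j))

colEntries : ∀ {m n} → Array m n → Fin n → List ℤ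
colEntries {m = m} A j = catMaybes (tabulate (λ i → A i j))

allEntries : ∀ {m n} → Array m n → List ℤ
allEntries {m = m} A = concat (tabulate (λ i → rowEntries A i))

posUpTo : ℕ → List ℤ
posUpTo k = map (λ i → + suc i) (upTo k)

Xset : ℕ → List ℤ
Xset N with N % 2
... | 0 = posUpTo (N / 2) ++ map ℤ.-_ (posUpTo (N / 2))
... | _ = 0ℤ ∷ (posUpTo (N / 2) ++ map ℤ.-_ (posUpTo (N / 2)))

sumℤ : List ℤ → ℤ
sumℤ = foldr ℤ._+_ 0ℤ

record IsSMR (m n r s : ℕ) (A : Array m n) : Set where
  field
    rowFilled  : ∀ i → length (rowEntries A i) ≡ r
    colFilled  : ∀ j → length (colEntries A j) ≡ s
    entriesX   : allEntries A ↭ Xset (m * r)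
    rowSumZero : ∀ i → sumℤ (rowEntries A i) ≡ 0ℤ
    colSumZero : ∀ j → sumℤ (colEntries A j) ≡ 0ℤ

#pos : List ℤ → ℕ
#pos xs = length (filter (λ x → 0ℤ ℤ.<? x) xs)

#neg : List ℤ → ℕ
#neg xs = length (filter (λ x → x ℤ.<? 0ℤ) xs)

Shiftable : ∀ {m n} → Array m n → Set
Shiftable A = (∀ i → #pos (rowEntries A i) ≡ #neg (rowEntries A i))
            × (∀ j → #pos (colEntries A j) ≡ #neg (colEntries A j))

module Submission where

-- Place k copies of A side by side with B, the copies having the absolute values of their entries
-- raised (signs kept) by mr′/2, mr′/2 + mr/2, …, mr′/2 + (k-1)mr/2. When mr and mr′ are even, the copies
-- then carry ±1, …, ±mr/2 onto consecutive ranges just above the values ±1, …, ±mr′/2 of B, and because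
-- every row and column of A has as many positive as negative entries, raising them changes no line sum;
-- the counts of positive and negative entries are unchanged too, so shiftability of B is inherited.
-- The case mr odd cannot occur: every row of A, having odd length, would contain a 0, forcing m = 1;
-- but the columns of a one-row SMR are single entries summing to 0, so B would contain 0, contradicting mr′ even.

open import Defs
open import Algebra.Bundles using (CommutativeMonoid)
import Algebra.Properties.CommutativeSemigroup as CommutativeSemigroupProperties
open import Data.Fin as Fin using (Fin; splitAt; _↑ˡ_; _↑ʳ_)
open import Data.Fin.Properties using (splitAt-↑ˡ; splitAt-↑ʳ)
open import Data.Integer as ℤ using (ℤ; +_; -[1+_]; 0ℤ; -_)
import Data.Integer.Properties as ℤ
import Data.Integer.Tactic.RingSolver as ℤ-Solver
open import Data.List using (List; []; _∷_; _++_; map; filter; length; foldr; applyUpTo; tabulate; catMaybes; concat)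
open import Data.List.Properties
  using (filter-++; length-++; foldr-++; map-++; length-map; map-tabulate; map-catMaybes; catMaybes-++; tabulate-cong; concat-map)
open import Data.List.Relation.Binary.Permutation.Propositional using (_↭_; ↭-refl; module PermutationReasoning)
open import Data.List.Relation.Binary.Permutation.Propositional.Properties
  using (++-commutativeMonoid; ++⁺ˡ; ++⁺; map⁺; ++-comm; ↭-length; filter-↭)
open import Data.Maybe as Maybe using (Maybe; just; nothing)
open import Data.Nat as ℕ using (ℕ; zero; suc; _+_; _*_; _%_; _/_; _<_; _≤_; _≥_; s≤s; z≤n; NonZero)
open import Data.Nat.Divisibility using (_∣_; _∣?_; divides; m%n≡0⇒n∣m; ∣-trans; n∣m*n)
open import Data.Nat.DivMod using (m*n%n≡0; m*n/n≡m)
import Data.Nat.Properties as ℕ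
import Data.Nat.Tactic.RingSolver as ℕ-Solver
open import Data.Product using (Σ; _×_; _,_)
open import Data.Sum using (inj₁; inj₂; [_,_]′)
open import Function using (id; _∘_)
open import Relation.Binary.PropositionalEquality
open import Relation.Nullary using (¬_; contradiction; yes; no)
open import Relation.Unary using (Pred; Decidable)

length-filter-++ : ∀ {a p} {A : Set a} {P : Pred A p} (P? : Decidable P) xs ys →
                   length (filter P? (xs ++ ys)) ≡ length (filter P? xs) + length (filter P? ys)
length-filter-++ P? xs ys = trans (cong length (filter-++ P? xs ys)) (length-++ (filter P? xs))

Balanced : List ℤ → Set
Balanced xs = #pos xs ≡ #neg xs

balanced-++ : ∀ xs ys → Balanced xs → Balanced ys → Balanced (xs ++ ys)
balanced-++ xs ys bxs bys = begin
  #pos (xs ++ ys)   ≡⟨ length-filter-++ (0ℤ ℤ.<?_) xs ys ⟩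
  #pos xs + #pos ys ≡⟨ cong₂ _+_ bxs bys ⟩
  #neg xs + #neg ys ≡⟨ sym (length-filter-++ (ℤ._<? 0ℤ) xs ys) ⟩
  #neg (xs ++ ys)   ∎
  where open ≡-Reasoning

shift : ℕ → ℤ → ℤ
shift c (+ zero)  = + zero
shift c (+ suc n) = + suc (n + c)
shift c -[1+ n ]  = -[1+ n + c ]

shift-neg : ∀ c x → shift c (- x) ≡ - shift c x
shift-neg c (+ zero)  = refl
shift-neg c (+ suc n) = refl
shift-neg c -[1+ n ]  = refl

#pos-map-shift : ∀ c xs → #pos (map (shift c) xs) ≡ #pos xs
#pos-map-shift c []              = refl
#pos-map-shift c (+ zero  ∷ xs)  = #pos-map-shift c xs
#pos-map-shift c (+ suc n ∷ xs)  = cong suc (#pos-map-shift c xs)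
#pos-map-shift c (-[1+ n ] ∷ xs) = #pos-map-shift c xs

#neg-map-shift : ∀ c xs → #neg (map (shift c) xs) ≡ #neg xs
#neg-map-shift c []              = refl
#neg-map-shift c (+ zero  ∷ xs)  = #neg-map-shift c xs
#neg-map-shift c (+ suc n ∷ xs)  = #neg-map-shift c xs
#neg-map-shift c (-[1+ n ] ∷ xs) = cong suc (#neg-map-shift c xs)

balanced-map-shift : ∀ c xs → Balanced xs → Balanced (map (shift c) xs)
balanced-map-shift c xs bxs = trans (#pos-map-shift c xs) (trans bxs (sym (#neg-map-shift c xs)))

sumℤ-map-shift : ∀ c xs → sumℤ (map (shift c) xs) ≡ sumℤ xs ℤ.+ (+ #pos xs ℤ.- + #neg xs) ℤ.* + c
sumℤ-map-shift c []              = refl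
sumℤ-map-shift c (+ zero  ∷ xs)  rewrite sumℤ-map-shift c xs = zero-step (sumℤ xs) ((+ #pos xs ℤ.- + #neg xs) ℤ.* + c)
  where
  zero-step : ∀ S d → + 0 ℤ.+ (S ℤ.+ d) ≡ (+ 0 ℤ.+ S) ℤ.+ d
  zero-step = ℤ-Solver.solve-∀
sumℤ-map-shift c (+ suc n ∷ xs)  rewrite sumℤ-map-shift c xs = pos-step (+ suc n) (+ c) (sumℤ xs) (+ #pos xs) (+ #neg xs)
  where
  pos-step : ∀ x c S p q → (x ℤ.+ c) ℤ.+ (S ℤ.+ (p ℤ.- q) ℤ.* c) ≡ (x ℤ.+ S) ℤ.+ ((+ 1 ℤ.+ p) ℤ.- q) ℤ.* c
  pos-step = ℤ-Solver.solve-∀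
sumℤ-map-shift c (-[1+ n ] ∷ xs) rewrite sumℤ-map-shift c xs = neg-step (+ suc n) (+ c) (sumℤ xs) (+ #pos xs) (+ #neg xs)
  where
  neg-step : ∀ x c S p q → - (x ℤ.+ c) ℤ.+ (S ℤ.+ (p ℤ.- q) ℤ.* c) ≡ (- x ℤ.+ S) ℤ.+ (p ℤ.- (+ 1 ℤ.+ q)) ℤ.* c
  neg-step = ℤ-Solver.solve-∀

sumℤ-map-shift-balanced : ∀ c xs → Balanced xs → sumℤ (map (shift c) xs) ≡ sumℤ xs
sumℤ-map-shift-balanced c xs pos≡neg = begin
  sumℤ (map (shift c) xs)                               ≡⟨ sumℤ-map-shift c xs ⟩
  sumℤ xs ℤ.+ (+ #pos xs ℤ.- + #neg xs) ℤ.* + c          ≡⟨ cong (λ p → sumℤ xs ℤ.+ (+ p ℤ.- + #neg xs) ℤ.* + c) pos≡neg ⟩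
  sumℤ xs ℤ.+ (+ #neg xs ℤ.- + #neg xs) ℤ.* + c          ≡⟨ cong (λ d → sumℤ xs ℤ.+ d ℤ.* + c) (ℤ.+-inverseʳ (+ #neg xs)) ⟩
  sumℤ xs ℤ.+ 0ℤ                                        ≡⟨ ℤ.+-identityʳ (sumℤ xs) ⟩
  sumℤ xs                                               ∎
  where open ≡-Reasoning

sumℤ-++-zeroʳ : ∀ xs ys → sumℤ ys ≡ 0ℤ → sumℤ (xs ++ ys) ≡ sumℤ xs
sumℤ-++-zeroʳ xs ys Σys≡0 = trans (foldr-++ ℤ._+_ 0ℤ xs ys) (cong (λ e → foldr ℤ._+_ e xs) Σys≡0)

interval : ℕ → ℕ → List ℤ
interval d zero    = []
interval d (suc h) = + suc d ∷ interval (suc d) h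

±interval : ℕ → ℕ → List ℤ
±interval d h = interval d h ++ map -_ (interval d h)

map-applyUpTo-interval : ∀ (f : ℕ → ℕ) d h → (∀ i → f i ≡ d + i) →
                         map (λ i → + suc i) (applyUpTo f h) ≡ interval d h
map-applyUpTo-interval f d zero    f≗d+ = refl
map-applyUpTo-interval f d (suc h) f≗d+ = cong₂ _∷_
  (cong (λ i → + suc i) (trans (f≗d+ 0) (ℕ.+-identityʳ d)))
  (map-applyUpTo-interval (f ∘ suc) (suc d) h (λ i → trans (f≗d+ (suc i)) (ℕ.+-suc d i)))

posUpTo≡interval : ∀ h → posUpTo h ≡ interval 0 h
posUpTo≡interval h = map-applyUpTo-interval id 0 h (λ _ → refl)

interval-+ : ∀ d a b → interval d (a + b) ≡ interval d a ++ interval (d + a) b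
interval-+ d zero    b = cong (λ e → interval e b) (sym (ℕ.+-identityʳ d))
interval-+ d (suc a) b = cong (+ suc d ∷_)
  (trans (interval-+ (suc d) a b) (cong (λ e → interval (suc d) a ++ interval e b) (sym (ℕ.+-suc d a))))

±interval-+ : ∀ d a b → ±interval d a ++ ±interval (d + a) b ↭ ±interval d (a + b)
±interval-+ d a b = begin
  (I₁ ++ map -_ I₁) ++ (I₂ ++ map -_ I₂) ↭⟨ interchange I₁ (map -_ I₁) I₂ (map -_ I₂) ⟩
  (I₁ ++ I₂) ++ (map -_ I₁ ++ map -_ I₂) ≡⟨ cong ((I₁ ++ I₂) ++_) (sym (map-++ -_ I₁ I₂)) ⟩
  (I₁ ++ I₂) ++ map -_ (I₁ ++ I₂)        ≡⟨ cong (λ K → K ++ map -_ K) (sym (interval-+ d a b)) ⟩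
  ±interval d (a + b)               ∎
  where
  open PermutationReasoning
  open CommutativeSemigroupProperties (CommutativeMonoid.commutativeSemigroup (++-commutativeMonoid {A = ℤ})) using (interchange)
  I₁ = interval d a
  I₂ = interval (d + a) b

map-shift-interval : ∀ c d h → map (shift c) (interval d h) ≡ interval (d + c) h
map-shift-interval c d zero    = refl
map-shift-interval c d (suc h) = cong (_ ∷_) (map-shift-interval c (suc d) h)

map-shift-±interval : ∀ c d h → map (shift c) (±interval d h) ≡ ±interval (d + c) h
map-shift-±interval c d h = begin
  map (shift c) (I ++ map -_ I)             ≡⟨ map-++ (shift c) I (map -_ I) ⟩
  map (shift c) I ++ map (shift c) (map -_ I) ≡⟨ cong (map (shift c) I ++_) (commute I) ⟩
  map (shift c) I ++ map -_ (map (shift c) I) ≡⟨ cong (λ K → K ++ map -_ K) (map-shift-interval c d h) ⟩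
  ±interval (d + c) h                       ∎
  where
  open ≡-Reasoning
  I = interval d h
  commute : ∀ xs → map (shift c) (map -_ xs) ≡ map -_ (map (shift c) xs)
  commute []       = refl
  commute (x ∷ xs) = cong₂ _∷_ (shift-neg c x) (commute xs)

Xset-even : ∀ N h → N ≡ h * 2 → Xset N ≡ ±interval 0 h
Xset-even N h refl = begin
  Xset (h * 2)                                         ≡⟨ Xset-%≡0 (h * 2) (m*n%n≡0 h 2) ⟩
  posUpTo (h * 2 / 2) ++ map -_ (posUpTo (h * 2 / 2))  ≡⟨ cong (λ K → K ++ map -_ K) (trans (cong posUpTo (m*n/n≡m h 2)) (posUpTo≡interval h)) ⟩
  ±interval 0 h                                        ∎
  where
  open ≡-Reasoning
  Xset-%≡0 : ∀ N → N % 2 ≡ 0 → Xset N ≡ posUpTo (N / 2) ++ map -_ (posUpTo (N / 2))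
  Xset-%≡0 N N%2≡0 with N % 2
  Xset-%≡0 N refl | .0 = refl

Xset-odd : ∀ N → ¬ 2 ∣ N → Xset N ≡ 0ℤ ∷ ±interval 0 (N / 2)
Xset-odd N 2∤N with N % 2 in N%2
... | zero  = contradiction (m%n≡0⇒n∣m N 2 N%2) 2∤N
... | suc _ = cong (λ K → 0ℤ ∷ K ++ map -_ K) (posUpTo≡interval (N / 2))

mapArray : ∀ {m n} → (ℤ → ℤ) → Array m n → Array m n
mapArray f A i j = Maybe.map f (A i j)

infixr 5 _∥_
_∥_ : ∀ {m n n′} → Array m n → Array m n′ → Array m (n + n′)
_∥_ {n = n} A B i j = [ A i , B i ]′ (splitAt n j)

catMaybes-tabulate-map : ∀ {a b} {A : Set a} {B : Set b} {n} (f : A → B) (F : Fin n → Maybe A) →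
                         catMaybes (tabulate (Maybe.map f ∘ F)) ≡ map f (catMaybes (tabulate F))
catMaybes-tabulate-map f F = trans (cong catMaybes (sym (map-tabulate F (Maybe.map f)))) (sym (map-catMaybes f (tabulate F)))

rowEntries-mapArray : ∀ {m n} f (A : Array m n) i → rowEntries (mapArray f A) i ≡ map f (rowEntries A i)
rowEntries-mapArray f A i = catMaybes-tabulate-map f (A i)

colEntries-mapArray : ∀ {m n} f (A : Array m n) j → colEntries (mapArray f A) j ≡ map f (colEntries A j)
colEntries-mapArray f A j = catMaybes-tabulate-map f (λ i → A i j)

allEntries-mapArray : ∀ {m n} f (A : Array m n) → allEntries (mapArray f A) ≡ map f (allEntries A)
allEntries-mapArray f A = begin
  concat (tabulate (rowEntries (mapArray f A))) ≡⟨ cong concat (tabulate-cong (rowEntries-mapArray f A)) ⟩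
  concat (tabulate (map f ∘ rowEntries A))      ≡⟨ cong concat (sym (map-tabulate (rowEntries A) (map f))) ⟩
  concat (map (map f) (tabulate (rowEntries A))) ≡⟨ concat-map (tabulate (rowEntries A)) ⟩
  map f (allEntries A)                          ∎
  where open ≡-Reasoning

tabulate-+ : ∀ {a} {A : Set a} m n (F : Fin (m + n) → A) →
             tabulate F ≡ tabulate (F ∘ (_↑ˡ n)) ++ tabulate (F ∘ (m ↑ʳ_))
tabulate-+ zero    n F = refl
tabulate-+ (suc m) n F = cong (F Fin.zero ∷_) (tabulate-+ m n (F ∘ Fin.suc))

rowEntries-∥ : ∀ {m n n′} (A : Array m n) (B : Array m n′) i → rowEntries (A ∥ B) i ≡ rowEntries A i ++ rowEntries B i
rowEntries-∥ {n = n} {n′} A B i = begin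
  catMaybes (tabulate F)                                                  ≡⟨ cong catMaybes (tabulate-+ n n′ F) ⟩
  catMaybes (tabulate (F ∘ (_↑ˡ n′)) ++ tabulate (F ∘ (n ↑ʳ_)))             ≡⟨ catMaybes-++ (tabulate (F ∘ (_↑ˡ n′))) _ ⟩
  catMaybes (tabulate (F ∘ (_↑ˡ n′))) ++ catMaybes (tabulate (F ∘ (n ↑ʳ_))) ≡⟨ cong₂ (λ xs ys → catMaybes xs ++ catMaybes ys)
                                                                                     (tabulate-cong left) (tabulate-cong right) ⟩
  rowEntries A i ++ rowEntries B i                                        ∎
  where
  open ≡-Reasoning
  F = (A ∥ B) i
  left : ∀ j → F (j ↑ˡ n′) ≡ A i j
  left j = cong [ A i , B i ]′ (splitAt-↑ˡ n j n′)
  right : ∀ j → F (n ↑ʳ j) ≡ B i j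
  right j = cong [ A i , B i ]′ (splitAt-↑ʳ n n′ j)

colEntries-∥-elim : ∀ {p m n n′} (P : List ℤ → Set p) (A : Array m n) (B : Array m n′) →
                    (∀ j → P (colEntries A j)) → (∀ j → P (colEntries B j)) → ∀ j → P (colEntries (A ∥ B) j)
colEntries-∥-elim {n = n} P A B PA PB j with splitAt n j
... | inj₁ j′ = PA j′
... | inj₂ j′ = PB j′

concat-tabulate-++ : ∀ {a} {A : Set a} m (f g : Fin m → List A) →
                     concat (tabulate (λ i → f i ++ g i)) ↭ concat (tabulate f) ++ concat (tabulate g)
concat-tabulate-++ zero    f g = ↭-refl
concat-tabulate-++ {A = A} (suc m) f g = begin
  (f Fin.zero ++ g Fin.zero) ++ concat (tabulate (λ i → f (Fin.suc i) ++ g (Fin.suc i)))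
    ↭⟨ ++⁺ˡ (f Fin.zero ++ g Fin.zero) (concat-tabulate-++ m (f ∘ Fin.suc) (g ∘ Fin.suc)) ⟩
  (f Fin.zero ++ g Fin.zero) ++ (concat (tabulate (f ∘ Fin.suc)) ++ concat (tabulate (g ∘ Fin.suc)))
    ↭⟨ interchange (f Fin.zero) (g Fin.zero) _ _ ⟩
  concat (tabulate f) ++ concat (tabulate g) ∎
  where
  open PermutationReasoning
  open CommutativeSemigroupProperties (CommutativeMonoid.commutativeSemigroup (++-commutativeMonoid {A = A})) using (interchange)

allEntries-∥ : ∀ {m n n′} (A : Array m n) (B : Array m n′) → allEntries (A ∥ B) ↭ allEntries A ++ allEntries B
allEntries-∥ {m} A B = begin
  concat (tabulate (rowEntries (A ∥ B)))                        ≡⟨ cong concat (tabulate-cong (rowEntries-∥ A B)) ⟩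
  concat (tabulate (λ i → rowEntries A i ++ rowEntries B i))     ↭⟨ concat-tabulate-++ m (rowEntries A) (rowEntries B) ⟩
  allEntries A ++ allEntries B                                   ∎
  where open PermutationReasoning

isSMR-∥-shift : ∀ {m n n′ r r′ s h′} {A : Array m n} {B : Array m n′} →
                IsSMR m n r s A → Shiftable A → 2 ∣ m * r →
                IsSMR m n′ r′ s B → m * r′ ≡ h′ * 2 →
                IsSMR m (n + n′) (r + r′) s (mapArray (shift h′) A ∥ B)
isSMR-∥-shift {m} {n} {n′} {r} {r′} {s} {h′} {A} {B} isA (rowsA , colsA) (divides h mr≡) isB mr′≡ = record
  { rowFilled  = λ i → let open ≡-Reasoning in begin
      length (rowEntries C i)                                             ≡⟨ cong length (row i) ⟩
      length (map (shift h′) (rowEntries A i) ++ rowEntries B i)          ≡⟨ length-++ (map (shift h′) (rowEntries A i)) ⟩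
      length (map (shift h′) (rowEntries A i)) + length (rowEntries B i)  ≡⟨ cong₂ _+_ (trans (length-map (shift h′) (rowEntries A i)) (A.rowFilled i)) (B.rowFilled i) ⟩
      r + r′                                                              ∎
  ; colFilled  = colEntries-∥-elim (λ xs → length xs ≡ s) A′ B
      (λ j → trans (cong length (colEntries-mapArray _ A j)) (trans (length-map (shift h′) (colEntries A j)) (A.colFilled j)))
      B.colFilled
  ; entriesX   = entries
  ; rowSumZero = λ i → let open ≡-Reasoning in begin
      sumℤ (rowEntries C i)                                     ≡⟨ cong sumℤ (row i) ⟩
      sumℤ (map (shift h′) (rowEntries A i) ++ rowEntries B i)  ≡⟨ sumℤ-++-zeroʳ (map (shift h′) (rowEntries A i)) (rowEntries B i) (B.rowSumZero i) ⟩
      sumℤ (map (shift h′) (rowEntries A i))                    ≡⟨ sumℤ-map-shift-balanced h′ (rowEntries A i) (rowsA i) ⟩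
      sumℤ (rowEntries A i)                                     ≡⟨ A.rowSumZero i ⟩
      0ℤ                                                        ∎
  ; colSumZero = colEntries-∥-elim (λ xs → sumℤ xs ≡ 0ℤ) A′ B
      (λ j → trans (cong sumℤ (colEntries-mapArray _ A j)) (trans (sumℤ-map-shift-balanced h′ (colEntries A j) (colsA j)) (A.colSumZero j)))
      B.colSumZero
  }
  where
  module A = IsSMR isA
  module B = IsSMR isB
  A′ = mapArray (shift h′) A
  C = A′ ∥ B

  half : m * (r + r′) ≡ (h′ + h) * 2
  half = let open ≡-Reasoning in begin
    m * (r + r′)      ≡⟨ ℕ.*-distribˡ-+ m r r′ ⟩
    m * r + m * r′    ≡⟨ cong₂ _+_ mr≡ mr′≡ ⟩
    h * 2 + h′ * 2    ≡⟨ ℕ.+-comm (h * 2) (h′ * 2) ⟩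
    h′ * 2 + h * 2    ≡⟨ ℕ.*-distribʳ-+ 2 h′ h ⟨
    (h′ + h) * 2      ∎

  row : ∀ i → rowEntries C i ≡ map (shift h′) (rowEntries A i) ++ rowEntries B i
  row i = trans (rowEntries-∥ A′ B i) (cong (_++ rowEntries B i) (rowEntries-mapArray _ A i))

  entries : allEntries C ↭ Xset (m * (r + r′))
  entries = let open PermutationReasoning in begin
    allEntries C                                    ↭⟨ allEntries-∥ A′ B ⟩
    allEntries A′ ++ allEntries B                   ≡⟨ cong (_++ allEntries B) (allEntries-mapArray _ A) ⟩
    map (shift h′) (allEntries A) ++ allEntries B   ↭⟨ ++⁺ (map⁺ (shift h′) A.entriesX) B.entriesX ⟩
    map (shift h′) (Xset (m * r)) ++ Xset (m * r′)  ≡⟨ cong₂ _++_ (trans (cong (map (shift h′)) (Xset-even _ h mr≡)) (map-shift-±interval h′ 0 h))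
                                                                  (Xset-even _ h′ mr′≡) ⟩
    ±interval h′ h ++ ±interval 0 h′                ↭⟨ ++-comm (±interval h′ h) (±interval 0 h′) ⟩
    ±interval 0 h′ ++ ±interval h′ h                ↭⟨ ±interval-+ 0 h′ h ⟩
    ±interval 0 (h′ + h)                            ≡⟨ Xset-even _ (h′ + h) half ⟨
    Xset (m * (r + r′))                             ∎

shiftable-∥-shift : ∀ {m n n′} c {A : Array m n} {B : Array m n′} → Shiftable A → Shiftable B → Shiftable (mapArray (shift c) A ∥ B)
shiftable-∥-shift c {A} {B} (rowsA , colsA) (rowsB , colsB) = rows , colEntries-∥-elim Balanced A′ B cols colsB
  where
  A′ = mapArray (shift c) A
  rows : ∀ i → Balanced (rowEntries (A′ ∥ B) i)
  rows i = subst Balanced (sym (trans (rowEntries-∥ A′ B i) (cong (_++ rowEntries B i) (rowEntries-mapArray _ A i))))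
                 (balanced-++ (map (shift c) (rowEntries A i)) (rowEntries B i) (balanced-map-shift c (rowEntries A i) (rowsA i)) (rowsB i))
  cols : ∀ j → Balanced (colEntries A′ j)
  cols j = subst Balanced (sym (colEntries-mapArray _ A j)) (balanced-map-shift c (colEntries A j) (colsA j))

isSMR-copies-∥ : ∀ {m n n′ r r′ s} {A : Array m n} {B : Array m n′} →
                 IsSMR m n r s A → Shiftable A → 2 ∣ m * r → IsSMR m n′ r′ s B → 2 ∣ m * r′ →
                 ∀ k → Σ (Array m (k * n + n′)) λ C → IsSMR m (k * n + n′) (k * r + r′) s C × (Shiftable B → Shiftable C)
isSMR-copies-∥ _ _ _ isB _ zero = _ , isB , id
isSMR-copies-∥ {m} {n} {n′} {r} {r′} {s} {A} {B} isA shA 2∣mr@(divides h mr≡) isB 2∣mr′@(divides h′ mr′≡) (suc k)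
  with isSMR-copies-∥ isA shA 2∣mr isB 2∣mr′ k
... | C , isC , shC =
  subst₂ (λ w R → Σ (Array m w) λ D → IsSMR m w R s D × (Shiftable B → Shiftable D))
         (sym (ℕ.+-assoc n (k * n) n′)) (sym (ℕ.+-assoc r (k * r) r′))
         (mapArray (shift (k * h + h′)) A ∥ C , isSMR-∥-shift isA shA 2∣mr isC half , shiftable-∥-shift _ shA ∘ shC)
  where
  half : m * (k * r + r′) ≡ (k * h + h′) * 2
  half = let open ≡-Reasoning in begin
    m * (k * r + r′)       ≡⟨ distrib m k r r′ ⟩
    k * (m * r) + m * r′   ≡⟨ cong₂ (λ a b → k * a + b) mr≡ mr′≡ ⟩
    k * (h * 2) + h′ * 2   ≡⟨ collect k h h′ ⟩
    (k * h + h′) * 2       ∎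
    where
    distrib : ∀ m k r r′ → m * (k * r + r′) ≡ k * (m * r) + m * r′
    distrib = ℕ-Solver.solve-∀
    collect : ∀ k h h′ → k * (h * 2) + h′ * 2 ≡ (k * h + h′) * 2
    collect = ℕ-Solver.solve-∀

#zero : List ℤ → ℕ
#zero xs = length (filter (ℤ._≟ 0ℤ) xs)

#zero-±interval : ∀ d h → #zero (±interval d h) ≡ 0
#zero-±interval d h = trans (length-filter-++ (ℤ._≟ 0ℤ) (interval d h) _) (cong₂ _+_ (positive d h) (negative d h))
  where
  positive : ∀ d h → #zero (interval d h) ≡ 0
  positive d zero    = refl
  positive d (suc h) = positive (suc d) h
  negative : ∀ d h → #zero (map -_ (interval d h)) ≡ 0
  negative d zero    = refl
  negative d (suc h) = negative (suc d) h

length≡#pos+#neg+#zero : ∀ xs → length xs ≡ #pos xs + #neg xs + #zero xs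
length≡#pos+#neg+#zero []              = refl
length≡#pos+#neg+#zero (+ zero  ∷ xs)  = trans (cong suc (length≡#pos+#neg+#zero xs)) (sym (ℕ.+-suc (#pos xs + #neg xs) (#zero xs)))
length≡#pos+#neg+#zero (+ suc n ∷ xs)  = cong suc (length≡#pos+#neg+#zero xs)
length≡#pos+#neg+#zero (-[1+ n ] ∷ xs) = trans (cong suc (length≡#pos+#neg+#zero xs)) (cong (_+ #zero xs) (sym (ℕ.+-suc (#pos xs) (#neg xs))))

#zero-↭ : ∀ {xs ys} → xs ↭ ys → #zero xs ≡ #zero ys
#zero-↭ xs↭ys = ↭-length (filter-↭ (ℤ._≟ 0ℤ) xs↭ys)

odd-balanced⇒zero : ∀ xs → ¬ 2 ∣ length xs → Balanced xs → 0 < #zero xs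
odd-balanced⇒zero xs 2∤len bxs with #zero xs in #zero≡
... | suc _ = s≤s z≤n
... | zero  = contradiction (divides (#pos xs) len≡) 2∤len
  where
  len≡ : length xs ≡ #pos xs * 2
  len≡ = begin
    length xs                    ≡⟨ length≡#pos+#neg+#zero xs ⟩
    #pos xs + #neg xs + #zero xs ≡⟨ cong₂ (λ q z → #pos xs + q + z) (sym bxs) #zero≡ ⟩
    #pos xs + #pos xs + 0        ≡⟨ ℕ.+-identityʳ _ ⟩
    #pos xs + #pos xs            ≡⟨ cong (_+_ (#pos xs)) (ℕ.+-identityʳ (#pos xs)) ⟨
    2 * #pos xs                  ≡⟨ ℕ.*-comm 2 (#pos xs) ⟩
    #pos xs * 2                  ∎
    where open ≡-Reasoning

rows≤#zero : ∀ {m} (f : Fin m → List ℤ) → (∀ i → 0 < #zero (f i)) → m ≤ #zero (concat (tabulate f))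
rows≤#zero {zero}  f _       = z≤n
rows≤#zero {suc m} f 0<#zero = subst (suc m ≤_) (sym (length-filter-++ (ℤ._≟ 0ℤ) (f Fin.zero) _))
  (ℕ.+-mono-≤ (0<#zero Fin.zero) (rows≤#zero (f ∘ Fin.suc) (0<#zero ∘ Fin.suc)))

odd-shiftable⇒one-row : ∀ {m n r s} {A : Array m n} → IsSMR m n r s A → Shiftable A → ¬ 2 ∣ m * r → m ≤ 1
odd-shiftable⇒one-row {m} {r = r} {A = A} isA (rowsA , _) 2∤mr = begin
  m                                ≤⟨ rows≤#zero (rowEntries A) (λ i → odd-balanced⇒zero (rowEntries A i) (2∤row i) (rowsA i)) ⟩
  #zero (allEntries A)             ≡⟨ #zero-↭ (IsSMR.entriesX isA) ⟩
  #zero (Xset (m * r))             ≡⟨ cong #zero (Xset-odd (m * r) 2∤mr) ⟩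
  suc (#zero (±interval 0 (m * r / 2))) ≡⟨ cong suc (#zero-±interval 0 (m * r / 2)) ⟩
  1                                ∎
  where
  open ℕ.≤-Reasoning
  2∤row : ∀ i → ¬ 2 ∣ length (rowEntries A i)
  2∤row i 2∣row = 2∤mr (∣-trans (subst (2 ∣_) (IsSMR.rowFilled isA i) 2∣row) (n∣m*n m))

single-row-#zero : ∀ {n r s} {B : Array 1 (suc n)} → NonZero s → IsSMR 1 (suc n) r s B → 0 < #zero (allEntries B)
single-row-#zero {s = s} {B} s≢0 isB = first-cell (B Fin.zero Fin.zero) (tabulate (B Fin.zero ∘ Fin.suc))
                                                  (IsSMR.colFilled isB Fin.zero) (IsSMR.colSumZero isB Fin.zero)
  where
  first-cell : ∀ e es → length (catMaybes (e ∷ [])) ≡ s → sumℤ (catMaybes (e ∷ [])) ≡ 0ℤ → 0 < #zero (catMaybes (e ∷ es) ++ [])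
  first-cell nothing          _ 0≡s _  = contradiction (sym 0≡s) (ℕ.≢-nonZero⁻¹ s {{s≢0}})
  first-cell (just (+ zero))  _ _   _  = s≤s z≤n
  first-cell (just (+ suc _)) _ _   ()
  first-cell (just -[1+ _ ])  _ _   ()

single-row⇒odd : ∀ {n r s} {B : Array 1 (suc n)} → NonZero s → IsSMR 1 (suc n) r s B → ¬ 2 ∣ 1 * r
single-row⇒odd {r = r} {B = B} s≢0 isB (divides h r≡) = ℕ.<-irrefl refl (begin-strict
  0                            <⟨ single-row-#zero s≢0 isB ⟩
  #zero (allEntries B)         ≡⟨ #zero-↭ (IsSMR.entriesX isB) ⟩
  #zero (Xset (1 * r))         ≡⟨ cong #zero (Xset-even (1 * r) h r≡) ⟩
  #zero (±interval 0 h)        ≡⟨ #zero-±interval 0 h ⟩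
  0                            ∎)
  where open ℕ.≤-Reasoning

odd-shiftable⇒odd : ∀ {m n n′ r r′ s} {A : Array m n} {B : Array m n′} → NonZero m → NonZero n′ → NonZero s →
                    IsSMR m n r s A → Shiftable A → ¬ 2 ∣ m * r → IsSMR m n′ r′ s B → ¬ 2 ∣ m * r′
odd-shiftable⇒odd {suc zero}    {n′ = suc _} _ _ s≢0 _   _   _    isB = single-row⇒odd s≢0 isB
odd-shiftable⇒odd {suc (suc _)}              _ _ _   isA shA 2∤mr _   = contradiction (odd-shiftable⇒one-row isA shA 2∤mr) λ { (s≤s ()) }

theorem6 : (m n n′ r r′ s : ℕ) → NonZero m → NonZero n → NonZero n′ → NonZero r → NonZero r′ → NonZero s →
           2 ∣ m * r′ →
           (A : Array m n) → IsSMR m n r s A → Shiftable A →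
           (B : Array m n′) → IsSMR m n′ r′ s B →
           (k : ℕ) → k ≥ 1 →
           Σ (Array m (k * n + n′)) (λ C → IsSMR m (k * n + n′) (k * r + r′) s C)
           × (Shiftable B → Σ (Array m (k * n + n′)) (λ C → IsSMR m (k * n + n′) (k * r + r′) s C × Shiftable C))
theorem6 m n n′ r r′ s m≢0 _ n′≢0 _ _ s≢0 2∣mr′ A isA shA B isB k _ with 2 ∣? m * r
... | no 2∤mr  = contradiction 2∣mr′ (odd-shiftable⇒odd m≢0 n′≢0 s≢0 isA shA 2∤mr isB)
... | yes 2∣mr = let C , isC , shC = isSMR-copies-∥ isA shA 2∣mr isB 2∣mr′ k
                 in (C , isC) , λ shB → C , isC , shC shB
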